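{- Let $m,n$ be positive integers and let $B_{mn}$ be the $m\times n$ grid of cells, where cell $(i,j)$ is in the $i$-th row from the top and $j$-th column from the left. Let $\mathcal{P}(B_{mn})$ be the set of lattice paths (unit steps up and right along grid lines) from the lower-left corner to the upper-right corner of $B_{mn}$, and let $f(i,j)$ be the number of paths in $\mathcal{P}(B_{mn})$ that lie below the cell $(i,j)$ (possibly touching the right or lower border of that cell). Then \[ \sum_{1\le i\le m,\ 1\le j\le n} f(i,j) \;=\; \binom{m+n}{m}\frac{mn}{2}. \] -}

module Defs where

open import Data.Nat using (ℕ; zero; suc; _≤?_; _∸_)
open import Data.List using (List; []; _∷_; map; _++_; filter; length)
open import Data.Fin using (Fin; toℕ)

data Step : Set where
  U R : Step

-- All lattice paths with exactly a up-steps and b right-steps, i.e. all paths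
-- from the lower-left corner (0,0) to the upper-right corner (b,a) of the
-- a×b grid (a rows, b columns).
paths : ℕ → ℕ → List (List Step)
paths zero    zero    = [] ∷ []
paths (suc a) zero    = map (U ∷_) (paths a zero)
paths zero    (suc b) = map (R ∷_) (paths zero b)
paths (suc a) (suc b) = map (U ∷_) (paths a (suc b)) ++ map (R ∷_) (paths (suc a) b)

-- heightAt p k = height (number of up-steps taken so far) at which the
-- (k+1)-st right-step of p is made, i.e. the height of the horizontal
-- segment of p in the (k+1)-st column.
heightAt : List Step → ℕ → ℕ
heightAt []      k       = 0
heightAt (U ∷ p) k       = suc (heightAt p k)
heightAt (R ∷ p) zero    = 0
heightAt (R ∷ p) (suc k) = heightAt p k

-- Cell (i+1, j+1) (1-indexed row from top, column from left) of the m×n grid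
-- occupies [j, j+1] × [m-(i+1), m-i].  A path lies below it (possibly touching
-- its lower or right border) iff its horizontal step in column j+1 is at
-- height ≤ m-(i+1).
-- f m n i j = number of paths in P(B_mn) lying below cell (i+1, j+1).
f : (m n : ℕ) → Fin m → Fin n → ℕ
f m n i j = length (filter (λ p → heightAt p (toℕ j) ≤? m ∸ suc (toℕ i)) (paths m n))

module Submission where

-- Summing f(i,j) over all cells is a double count: a path p
-- is counted once for every cell lying above it, so the left-hand side is
-- the total area above all paths,
--     A(m,n) = Σ_{p ∈ P(B_mn)} Σ_{j < n} (m ∸ height of p in column j).
-- Splitting paths by their first step gives the recursions
--     #P(a+1,b+1) = #P(a,b+1) + #P(a+1,b)
--     A(a+1,b+1)  = A(a,b+1) + A(a+1,b) + (a+1)·#P(a+1,b)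
-- (a path starting with a right step gains a full first column of height
-- a+1).  Together with the balance identity (b+1)·#P(a,b+1) = (a+1)·#P(a+1,b)
-- they give 2·A(a,b) = #P(a,b)·a·b by induction, and #P(a,b) = C(a+b,a).

open import Defs
open import Data.Nat using (ℕ; zero; suc; _+_; _*_; _≤_; _∸_; _≤?_)
open import Data.Nat.Properties
open import Data.Nat.Combinatorics using (_C_; nCn≡1; nC1≡n; nCk+nC[k+1]≡[n+1]C[k+1])
open import Data.Nat.Tactic.RingSolver using (solve-∀)
open import Data.Nat.ListAction using (sum)
open import Data.Nat.ListAction.Properties using (sum-++)
open import Data.List using (List; []; _∷_; _++_; map; allFin; filter; length; tabulate)
open import Data.List.Properties using (map-cong; map-∘; map-++; map-tabulate; length-++; length-map)
open import Data.Fin using (Fin; toℕ)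
open import Data.Bool using (if_then_else_; true; false)
open import Relation.Nullary using (Dec; does; yes; no; ¬_)
open import Relation.Nullary.Decidable using (dec-true; dec-false)
open import Relation.Unary using (Decidable)
open import Relation.Binary.PropositionalEquality
open import Function using (_∘_)

open ≡-Reasoning

sum-cong : ∀ {A : Set} {g h : A → ℕ} → (∀ x → g x ≡ h x) → (xs : List A) →
  sum (map g xs) ≡ sum (map h xs)
sum-cong g≗h xs = cong sum (map-cong g≗h xs)

sum-const : ∀ {A : Set} (c : ℕ) (xs : List A) → sum (map (λ _ → c) xs) ≡ length xs * c
sum-const c []       = refl
sum-const c (x ∷ xs) = cong (c +_) (sum-const c xs)

sum-zeros : ∀ {A : Set} {g : A → ℕ} → (∀ x → g x ≡ 0) → (xs : List A) → sum (map g xs) ≡ 0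
sum-zeros g≗0 xs = trans (sum-cong g≗0 xs) (trans (sum-const 0 xs) (*-zeroʳ (length xs)))

sum-+ : ∀ {A : Set} (g h : A → ℕ) (xs : List A) →
  sum (map (λ x → g x + h x) xs) ≡ sum (map g xs) + sum (map h xs)
sum-+ g h []       = refl
sum-+ g h (x ∷ xs) = begin
  g x + h x + sum (map (λ x → g x + h x) xs)   ≡⟨ cong (g x + h x +_) (sum-+ g h xs) ⟩
  g x + h x + (sum (map g xs) + sum (map h xs)) ≡⟨ interchange (g x) (h x) _ _ ⟩
  g x + sum (map g xs) + (h x + sum (map h xs)) ∎
  where
  interchange : ∀ a b c d → a + b + (c + d) ≡ a + c + (b + d)
  interchange = solve-∀

sum-swap : ∀ {A B : Set} (g : A → B → ℕ) (xs : List A) (ys : List B) →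
  sum (map (λ x → sum (map (g x) ys)) xs) ≡ sum (map (λ y → sum (map (λ x → g x y) xs)) ys)
sum-swap g []       ys = sym (sum-zeros (λ _ → refl) ys)
sum-swap g (x ∷ xs) ys = begin
  sum (map (g x) ys) + sum (map (λ x → sum (map (g x) ys)) xs)
    ≡⟨ cong (sum (map (g x) ys) +_) (sum-swap g xs ys) ⟩
  sum (map (g x) ys) + sum (map (λ y → sum (map (λ x → g x y) xs)) ys)
    ≡⟨ sym (sum-+ (g x) (λ y → sum (map (λ x → g x y) xs)) ys) ⟩
  sum (map (λ y → g x y + sum (map (λ x → g x y) xs)) ys) ∎

𝟙 : ∀ {P : Set} → Dec P → ℕ
𝟙 d = if does d then 1 else 0

length-filter-sum : ∀ {A : Set} {P : A → Set} (P? : Decidable P) (xs : List A) →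
  length (filter P? xs) ≡ sum (map (λ x → 𝟙 (P? x)) xs)
length-filter-sum P? [] = refl
length-filter-sum P? (x ∷ xs) with does (P? x)
... | true  = cong suc (length-filter-sum P? xs)
... | false = length-filter-sum P? xs

𝟙-yes : ∀ {P : Set} (d : Dec P) → P → 𝟙 d ≡ 1
𝟙-yes d p = cong (λ b → if b then 1 else 0) (dec-true d p)

𝟙-no : ∀ {P : Set} (d : Dec P) → ¬ P → 𝟙 d ≡ 0
𝟙-no d ¬p = cong (λ b → if b then 1 else 0) (dec-false d ¬p)

Σ< : ℕ → (ℕ → ℕ) → ℕ
Σ< zero    g = 0
Σ< (suc m) g = g 0 + Σ< m (g ∘ suc)

sum-allFin : ∀ m (g : ℕ → ℕ) → sum (map (g ∘ toℕ) (allFin m)) ≡ Σ< m g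
sum-allFin m g = trans (cong sum (map-tabulate {n = m} (λ i → i) (g ∘ toℕ))) (sum-tabulate m g)
  where
  sum-tabulate : ∀ m (g : ℕ → ℕ) → sum (tabulate {n = m} (g ∘ toℕ)) ≡ Σ< m g
  sum-tabulate zero    g = refl
  sum-tabulate (suc m) g = cong (g 0 +_) (sum-tabulate m (g ∘ suc))

-- In a column of m cells, numbered 0, …, m-1 from the top, exactly m ∸ h
-- cells i satisfy h ≤ m-1-i, i.e. lie above height h.
cells-above : ∀ m h → Σ< m (λ i → 𝟙 (h ≤? m ∸ suc i)) ≡ m ∸ h
cells-above zero    h = sym (0∸n≡0 h)
cells-above (suc m) h with h ≤? m
... | yes h≤m = trans (cong₂ _+_ (𝟙-yes (h ≤? m) h≤m) (cells-above m h)) (sym (+-∸-assoc 1 h≤m))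
... | no  h≰m = trans (cong₂ _+_ (𝟙-no (h ≤? m) h≰m) (cells-above m h))
                  (trans (m≤n⇒m∸n≡0 (<⇒≤ (≰⇒> h≰m))) (sym (m≤n⇒m∸n≡0 (≰⇒> h≰m))))

#paths : ℕ → ℕ → ℕ
#paths a b = length (paths a b)

#paths-no-rows : ∀ b → #paths 0 b ≡ 1
#paths-no-rows zero    = refl
#paths-no-rows (suc b) = trans (length-map (R ∷_) (paths 0 b)) (#paths-no-rows b)

#paths-no-cols : ∀ a → #paths a 0 ≡ 1
#paths-no-cols zero    = refl
#paths-no-cols (suc a) = trans (length-map (U ∷_) (paths a 0)) (#paths-no-cols a)

#paths-step : ∀ a b → #paths (suc a) (suc b) ≡ #paths a (suc b) + #paths (suc a) b
#paths-step a b = trans (length-++ (map (U ∷_) (paths a (suc b))))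
  (cong₂ _+_ (length-map (U ∷_) (paths a (suc b))) (length-map (R ∷_) (paths (suc a) b)))

#paths≡binomial : ∀ a b → #paths a b ≡ (a + b) C a
#paths≡binomial zero    b       = #paths-no-rows b
#paths≡binomial (suc a) zero    = begin
  #paths (suc a) 0        ≡⟨ #paths-no-cols (suc a) ⟩
  1                       ≡⟨ sym (nCn≡1 (suc a)) ⟩
  suc a C suc a           ≡⟨ cong (_C suc a) (sym (+-identityʳ (suc a))) ⟩
  (suc a + 0) C suc a     ∎
#paths≡binomial (suc a) (suc b) = begin
  #paths (suc a) (suc b)                    ≡⟨ #paths-step a b ⟩
  #paths a (suc b) + #paths (suc a) b       ≡⟨ cong₂ _+_ (#paths≡binomial a (suc b)) (#paths≡binomial (suc a) b) ⟩
  (a + suc b) C a + (suc a + b) C suc a     ≡⟨ cong (λ k → (a + suc b) C a + k C suc a) (sym (+-suc a b)) ⟩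
  (a + suc b) C a + (a + suc b) C suc a     ≡⟨ nCk+nC[k+1]≡[n+1]C[k+1] (a + suc b) a ⟩
  (suc a + suc b) C suc a                   ∎

#paths-one-row : ∀ b → #paths 1 b ≡ suc b
#paths-one-row b = trans (#paths≡binomial 1 b) (nC1≡n (suc b))

#paths-one-col : ∀ a → #paths a 1 ≡ suc a
#paths-one-col zero    = refl
#paths-one-col (suc a) = trans (#paths-step a 0)
  (trans (cong₂ _+_ (#paths-one-col a) (#paths-no-cols (suc a))) (+-comm (suc a) 1))

-- Balance identity (b+1)·#P(a,b+1) = (a+1)·#P(a+1,b): both count the
-- paths of length a+b+1 with a marked right step, resp. up step.
#paths-balance : ∀ a b → suc b * #paths a (suc b) ≡ suc a * #paths (suc a) b
#paths-balance zero b = begin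
  suc b * #paths 0 (suc b)  ≡⟨ cong (suc b *_) (#paths-no-rows (suc b)) ⟩
  suc b * 1                 ≡⟨ *-identityʳ (suc b) ⟩
  suc b                     ≡⟨ sym (#paths-one-row b) ⟩
  #paths 1 b                ≡⟨ sym (+-identityʳ (#paths 1 b)) ⟩
  1 * #paths 1 b            ∎
#paths-balance (suc a) zero = begin
  1 * #paths (suc a) 1       ≡⟨ *-identityˡ (#paths (suc a) 1) ⟩
  #paths (suc a) 1           ≡⟨ #paths-one-col (suc a) ⟩
  suc (suc a)                ≡⟨ sym (*-identityʳ (suc (suc a))) ⟩
  suc (suc a) * 1            ≡⟨ cong (suc (suc a) *_) (sym (#paths-no-cols (suc (suc a)))) ⟩
  suc (suc a) * #paths (suc (suc a)) 0 ∎
#paths-balance (suc a) (suc b) = begin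
  suc (suc b) * #paths (suc a) (suc (suc b))   ≡⟨ cong (suc (suc b) *_) (#paths-step a (suc b)) ⟩
  suc (suc b) * (X + Y)                        ≡⟨ *-distribˡ-+ (suc (suc b)) X Y ⟩
  suc (suc b) * X + suc (suc b) * Y            ≡⟨ cong (_+ suc (suc b) * Y) (#paths-balance a (suc b)) ⟩
  suc a * Y + suc (suc b) * Y                  ≡⟨ shift (suc a) (suc b) Y ⟩
  suc (suc a) * Y + suc b * Y                  ≡⟨ cong (suc (suc a) * Y +_) (#paths-balance (suc a) b) ⟩
  suc (suc a) * Y + suc (suc a) * Z            ≡⟨ sym (*-distribˡ-+ (suc (suc a)) Y Z) ⟩
  suc (suc a) * (Y + Z)                        ≡⟨ cong (suc (suc a) *_) (sym (#paths-step (suc a) b)) ⟩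
  suc (suc a) * #paths (suc (suc a)) (suc b)   ∎
  where
  X = #paths a (suc (suc b))
  Y = #paths (suc a) (suc b)
  Z = #paths (suc (suc a)) b
  shift : ∀ p q y → p * y + suc q * y ≡ suc p * y + q * y
  shift = solve-∀

areaAbove : ℕ → ℕ → List Step → ℕ
areaAbove a b p = Σ< b (λ j → a ∸ heightAt p j)

totalArea : ℕ → ℕ → ℕ
totalArea a b = sum (map (areaAbove a b) (paths a b))

totalArea-no-rows : ∀ b → totalArea 0 b ≡ 0
totalArea-no-rows b = sum-zeros (λ p → Σ<-zeros b (λ j → 0∸n≡0 (heightAt p j))) (paths 0 b)
  where
  Σ<-zeros : ∀ b {g : ℕ → ℕ} → (∀ j → g j ≡ 0) → Σ< b g ≡ 0
  Σ<-zeros zero    g≗0 = refl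
  Σ<-zeros (suc b) g≗0 = cong₂ _+_ (g≗0 0) (Σ<-zeros b (g≗0 ∘ suc))

totalArea-no-cols : ∀ a → totalArea a 0 ≡ 0
totalArea-no-cols a = sum-zeros (λ _ → refl) (paths a 0)

-- Split by the first step.  After an up step the path sees one row less
-- above it; after a right step the first column (a+1 cells) lies entirely
-- above it and the rest is a path of P(B_(a+1)b).
totalArea-step : ∀ a b →
  totalArea (suc a) (suc b) ≡ totalArea a (suc b) + (#paths (suc a) b * suc a + totalArea (suc a) b)
totalArea-step a b = begin
  totalArea (suc a) (suc b)
    ≡⟨ cong sum (map-++ area (map (U ∷_) ups) (map (R ∷_) rights)) ⟩
  sum (map area (map (U ∷_) ups) ++ map area (map (R ∷_) rights))
    ≡⟨ sum-++ (map area (map (U ∷_) ups)) (map area (map (R ∷_) rights)) ⟩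
  sum (map area (map (U ∷_) ups)) + sum (map area (map (R ∷_) rights))
    ≡⟨ cong₂ _+_ (cong sum (sym (map-∘ ups))) (cong sum (sym (map-∘ rights))) ⟩
  totalArea a (suc b) + sum (map (λ p → suc a + areaAbove (suc a) b p) rights)
    ≡⟨ cong (totalArea a (suc b) +_) (sum-+ (λ _ → suc a) (areaAbove (suc a) b) rights) ⟩
  totalArea a (suc b) + (sum (map (λ _ → suc a) rights) + totalArea (suc a) b)
    ≡⟨ cong (λ s → totalArea a (suc b) + (s + totalArea (suc a) b)) (sum-const (suc a) rights) ⟩
  totalArea a (suc b) + (#paths (suc a) b * suc a + totalArea (suc a) b) ∎
  where
  area   = areaAbove (suc a) (suc b)
  ups    = paths a (suc b)
  rights = paths (suc a) b

twice-totalArea : ∀ a b → 2 * totalArea a b ≡ #paths a b * (a * b)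
twice-totalArea zero    b       = begin
  2 * totalArea 0 b   ≡⟨ cong (2 *_) (totalArea-no-rows b) ⟩
  0                   ≡⟨ sym (*-zeroʳ (#paths 0 b)) ⟩
  #paths 0 b * 0      ∎
twice-totalArea (suc a) zero    = begin
  2 * totalArea (suc a) 0        ≡⟨ cong (2 *_) (totalArea-no-cols (suc a)) ⟩
  0                              ≡⟨ sym (*-zeroʳ (#paths (suc a) 0)) ⟩
  #paths (suc a) 0 * 0           ≡⟨ cong (#paths (suc a) 0 *_) (sym (*-zeroʳ (suc a))) ⟩
  #paths (suc a) 0 * (suc a * 0) ∎
twice-totalArea (suc a) (suc b) = begin
  2 * totalArea (suc a) (suc b)
    ≡⟨ cong (2 *_) (totalArea-step a b) ⟩
  2 * (totalArea a (suc b) + (Y * suc a + totalArea (suc a) b))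
    ≡⟨ regroup (totalArea a (suc b)) (totalArea (suc a) b) Y a ⟩
  2 * totalArea a (suc b) + 2 * totalArea (suc a) b + 2 * (suc a * Y)
    ≡⟨ cong₂ (λ u v → u + v + 2 * (suc a * Y)) (twice-totalArea a (suc b)) (twice-totalArea (suc a) b) ⟩
  X * (a * suc b) + Y * (suc a * b) + 2 * (suc a * Y)
    ≡⟨ split-column X Y a b ⟩
  X * (a * suc b) + Y * (suc a * suc b) + suc a * Y
    ≡⟨ cong (X * (a * suc b) + Y * (suc a * suc b) +_) (sym (#paths-balance a b)) ⟩
  X * (a * suc b) + Y * (suc a * suc b) + suc b * X
    ≡⟨ collect X Y a b ⟩
  (X + Y) * (suc a * suc b)
    ≡⟨ cong (_* (suc a * suc b)) (sym (#paths-step a b)) ⟩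
  #paths (suc a) (suc b) * (suc a * suc b) ∎
  where
  X = #paths a (suc b)
  Y = #paths (suc a) b
  regroup : ∀ t u y a → 2 * (t + (y * suc a + u)) ≡ 2 * t + 2 * u + 2 * (suc a * y)
  regroup = solve-∀
  split-column : ∀ x y a b →
    x * (a * suc b) + y * (suc a * b) + 2 * (suc a * y) ≡ x * (a * suc b) + y * (suc a * suc b) + suc a * y
  split-column = solve-∀
  collect : ∀ x y a b → x * (a * suc b) + y * (suc a * suc b) + suc b * x ≡ (x + y) * (suc a * suc b)
  collect = solve-∀

-- Summing f over the cells of column j counts every path once for each
-- cell of that column lying above it.
column-sum : ∀ m n (j : Fin n) →
  sum (map (λ i → f m n i j) (allFin m)) ≡ sum (map (λ p → m ∸ heightAt p (toℕ j)) (paths m n))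
column-sum m n j = begin
  sum (map (λ i → f m n i j) (allFin m))
    ≡⟨ sum-cong (λ i → length-filter-sum (below i) (paths m n)) (allFin m) ⟩
  sum (map (λ i → sum (map (λ p → 𝟙 (below i p)) (paths m n))) (allFin m))
    ≡⟨ sum-swap (λ i p → 𝟙 (below i p)) (allFin m) (paths m n) ⟩
  sum (map (λ p → sum (map (λ i → 𝟙 (below i p)) (allFin m))) (paths m n))
    ≡⟨ sum-cong (λ p → column-count p) (paths m n) ⟩
  sum (map (λ p → m ∸ heightAt p (toℕ j)) (paths m n)) ∎
  where
  below : (i : Fin m) (p : List Step) → Dec (heightAt p (toℕ j) ≤ m ∸ suc (toℕ i))
  below i p = heightAt p (toℕ j) ≤? m ∸ suc (toℕ i)
  column-count : ∀ p → sum (map (λ i → 𝟙 (below i p)) (allFin m)) ≡ m ∸ heightAt p (toℕ j)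
  column-count p = trans (sum-allFin m (λ i → 𝟙 (heightAt p (toℕ j) ≤? m ∸ suc i)))
                         (cells-above m (heightAt p (toℕ j)))

cell-sum≡totalArea : ∀ m n →
  sum (map (λ i → sum (map (λ j → f m n i j) (allFin n))) (allFin m)) ≡ totalArea m n
cell-sum≡totalArea m n = begin
  sum (map (λ i → sum (map (λ j → f m n i j) (allFin n))) (allFin m))
    ≡⟨ sum-swap (f m n) (allFin m) (allFin n) ⟩
  sum (map (λ j → sum (map (λ i → f m n i j) (allFin m))) (allFin n))
    ≡⟨ sum-cong (column-sum m n) (allFin n) ⟩
  sum (map (λ j → sum (map (λ p → m ∸ heightAt p (toℕ j)) (paths m n))) (allFin n))
    ≡⟨ sum-swap (λ j p → m ∸ heightAt p (toℕ j)) (allFin n) (paths m n) ⟩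
  sum (map (λ p → sum (map (λ j → m ∸ heightAt p (toℕ j)) (allFin n))) (paths m n))
    ≡⟨ sum-cong (λ p → sum-allFin n (λ j → m ∸ heightAt p j)) (paths m n) ⟩
  totalArea m n ∎

lemma2p4 : (m n : ℕ) → 1 ≤ m → 1 ≤ n →
    2 * sum (map (λ i → sum (map (λ j → f m n i j) (allFin n))) (allFin m))
      ≡ ((m + n) C m) * (m * n)
lemma2p4 m n _ _ = begin
  2 * sum (map (λ i → sum (map (λ j → f m n i j) (allFin n))) (allFin m))
    ≡⟨ cong (2 *_) (cell-sum≡totalArea m n) ⟩
  2 * totalArea m n
    ≡⟨ twice-totalArea m n ⟩
  #paths m n * (m * n)
    ≡⟨ cong (_* (m * n)) (#paths≡binomial m n) ⟩
  ((m + n) C m) * (m * n) ∎
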